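{- For every $n\in\mathbb{N}$, $\mathscr{G}_n\cup\mathscr{G}_n^{ -1}=S_n(321,2143)$. Moreover, \[ \left|\mathscr{G}_n\cup\mathscr{G}_n^{ -1}\right| = 2^{n+1}-\binom{n+1}{3}-2n-1. \]
   Context: A permutation $\pi\in S_n$ has a descent at position $i$ if $\pi(i)>\pi(i+1)$. A permutation is Grassmannian if it has at most one descent; $\mathscr{G}_n$ is the set of Grassmannian permutations of $[n]$, and $\mathscr{G}_n^{ -1}=\{\pi^{ -1}:\pi\in\mathscr{G}_n\}$. $S_n(321,2143)$ is the set of permutations of $[n]$ avoiding both classical patterns $321$ and $2143$. -}

module Defs where

open import Data.Nat using (ℕ; suc)
open import Data.Fin using (Fin; toℕ; _<_)
open import Data.Vec using (Vec; lookup)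
open import Data.Product using (Σ; ∃; _×_)
open import Data.Sum using (_⊎_)
open import Relation.Binary.PropositionalEquality using (_≡_)
open import Relation.Nullary using (¬_)

-- A permutation of [n] in one-line notation: the word π(1) … π(n),
-- stored as a vector over Fin n (values 0..n-1), required to be injective
-- (hence bijective, since Fin n is finite).
IsPerm : ∀ {n} → Vec (Fin n) n → Set
IsPerm {n} π = ∀ (i j : Fin n) → lookup π i ≡ lookup π j → i ≡ j

DescentAt : ∀ {n} → Vec (Fin n) n → Fin n → Set
DescentAt {n} π i = Σ (Fin n) λ j → (toℕ j ≡ suc (toℕ i)) × (lookup π j < lookup π i)

Grassmannian : ∀ {n} → Vec (Fin n) n → Set
Grassmannian π = ∀ i i' → DescentAt π i → DescentAt π i' → i ≡ i'

IsInverseOf : ∀ {n} → Vec (Fin n) n → Vec (Fin n) n → Set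
IsInverseOf {n} σ π = ∀ (i : Fin n) → lookup σ (lookup π i) ≡ i

InG : ∀ {n} → Vec (Fin n) n → Set
InG π = IsPerm π × Grassmannian π

InGinv : ∀ {n} → Vec (Fin n) n → Set
InGinv {n} π = IsPerm π × Σ (Vec (Fin n) n) λ σ → InG σ × IsInverseOf π σ

Contains321 : ∀ {n} → Vec (Fin n) n → Set
Contains321 {n} π = Σ (Fin n) λ a → Σ (Fin n) λ b → Σ (Fin n) λ c →
  (a < b) × (b < c) × (lookup π b < lookup π a) × (lookup π c < lookup π b)

Contains2143 : ∀ {n} → Vec (Fin n) n → Set
Contains2143 {n} π = Σ (Fin n) λ a → Σ (Fin n) λ b → Σ (Fin n) λ c → Σ (Fin n) λ d →
  (a < b) × (b < c) × (c < d) ×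
  (lookup π b < lookup π a) × (lookup π a < lookup π d) × (lookup π d < lookup π c)

InAvoid : ∀ {n} → Vec (Fin n) n → Set
InAvoid π = IsPerm π × ¬ Contains321 π × ¬ Contains2143 π

InGUnion : ∀ {n} → Vec (Fin n) n → Set
InGUnion π = InG π ⊎ InGinv π

{-# OPTIONS --safe #-}
-- Every inversion of a Grassmannian permutation spans its unique descent, so two
-- inversions forming a 321 or the two outer inversions of a 2143 would need two
-- descents; as both patterns are involutions, the same holds for inverses. Conversely,
-- let π avoid 321 and 2143. Each descent of π separates the positions of u + 1 and u
-- for every inverse descent u, and so do its two values; two descents together with two
-- inverse descents then always produce a 321 or a 2143, so π or π⁻¹ is Grassmannian.
--
-- For the count, the inverse of a Grassmannian permutation is the shuffle of a binary
-- word w (the positions marked true receive the smallest values, in order). The descents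
-- of the shuffle are the ascents false, true of w, so the shuffle is the identity for the
-- n + 1 words without ascent and Grassmannian for the C(n+1, 3) words with one ascent.
-- Thus 𝒢ₙ ∪ 𝒢ₙ⁻¹ consists of the identity, the 2ⁿ − (n + 1) permutations in 𝒢ₙ ∖ {id},
-- and the 2ⁿ − (n + 1) − C(n+1, 3) shuffles with at least two ascents.
module Submission where

open import Defs
open import Data.Bool using (Bool; true; false; T; _∧_; _∨_)
open import Data.Empty using (⊥; ⊥-elim)
open import Data.Fin as Fin using (Fin; zero; suc; toℕ; inject₁; punchIn; punchOut)
open import Data.Fin.Properties as Finₚ using (toℕ-injective; toℕ-inject₁; any?)
open import Data.List using (List; []; _∷_; _++_; map; length; filter)
open import Data.List.Membership.Propositional using (_∈_)
open import Data.List.Relation.Unary.Unique.Propositional using (Unique)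
import Data.List.Relation.Unary.Unique.Propositional.Properties as Uniqueₚ
open import Data.List.Relation.Unary.AllPairs using ([]; _∷_)
import Data.List.Relation.Unary.All as All
import Data.List.Relation.Unary.All.Properties as Allₚ
open import Data.List.Relation.Unary.Any using (here; there)
open import Data.List.Membership.Propositional.Properties
  using (∈-filter⁺; ∈-filter⁻; ∈-map⁺; ∈-map⁻; ∈-++⁺ˡ; ∈-++⁺ʳ; ∈-++⁻)
open import Data.List.Properties using (length-++; length-map; filter-++; filter-≐)
open import Data.Nat as ℕ using (ℕ; zero; suc; _+_; _*_; _^_; _∸_; _≡ᵇ_; _<ᵇ_; z≤n; s≤s)
open import Data.Nat.Combinatorics using (_C_; nC1≡n; nCk+nC[k+1]≡[n+1]C[k+1])
import Data.Nat.Properties as ℕₚ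
open import Data.Nat.Solver using (module +-*-Solver)
open import Algebra.Properties.CommutativeSemigroup ℕₚ.+-commutativeSemigroup
  using () renaming (interchange to +-interchange)
open import Data.Product using (Σ; ∃-syntax; _×_; _,_; proj₁; proj₂)
open import Data.Sum using (_⊎_; inj₁; inj₂; [_,_]′)
open import Data.Vec using (Vec; []; _∷_; lookup; tabulate; allFin)
open import Data.Vec.Properties using (∷-injectiveʳ; lookup∘tabulate; tabulate∘lookup; tabulate-cong; lookup-allFin)
open import Function.Base using (_∘_)
open import Function.Bundles using (_⇔_; mk⇔)
open import Relation.Binary using (tri<; tri≈; tri>)
open import Relation.Binary.PropositionalEquality
  using (_≡_; _≢_; refl; sym; trans; cong; cong₂; subst; subst₂; module ≡-Reasoning)
open import Relation.Nullary using (¬_; Dec; does; yes; no)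
open import Relation.Nullary.Decidable using (T?; _×-dec_; ¬?; dec-true; dec-false)

private variable n : ℕ

infix 8 _!_
_!_ : Vec (Fin n) n → Fin n → ℕ
π ! i = toℕ (lookup π i)

descent-between : (π : Vec (Fin n) n) {a b : Fin n} → a Fin.< b → π ! b ℕ.< π ! a →
                  ∃[ i ] DescentAt π i × toℕ a ℕ.≤ toℕ i × i Fin.< b
descent-between π {a} {b} a<b =
  let k , 1+a+k≡b = ℕₚ.m≤n⇒∃[o]m+o≡n a<b
  in  go k b (trans (sym 1+a+k≡b) (cong suc (ℕₚ.+-comm (toℕ a) k)))
  where
  below : ∀ {m} k (b : Fin m) → toℕ (suc b) ≡ suc (k + toℕ a) → toℕ (inject₁ b) ≡ k + toℕ a
  below k b e = trans (toℕ-inject₁ b) (ℕₚ.suc-injective e)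
  go : ∀ k b → toℕ b ≡ suc (k + toℕ a) → π ! b ℕ.< π ! a →
       ∃[ i ] DescentAt π i × toℕ a ℕ.≤ toℕ i × i Fin.< b
  go k (suc b) b≡ πb<πa with π ! suc b ℕ.<? π ! inject₁ b
  ... | yes desc = inject₁ b , (suc b , cong suc (sym (toℕ-inject₁ b)) , desc) ,
                   subst (toℕ a ℕ.≤_) (sym (below k b b≡)) (ℕₚ.m≤n+m (toℕ a) k) ,
                   Finₚ.≤̄⇒inject₁< Finₚ.≤-refl
  go zero (suc b) b≡ πb<πa | no ¬desc =
    ⊥-elim (ℕₚ.<⇒≱ πb<πa (subst (λ c → π ! c ℕ.≤ π ! suc b) (toℕ-injective (below 0 b b≡))
                                (ℕₚ.≮⇒≥ ¬desc)))
  go (suc k) (suc b) b≡ πb<πa | no ¬desc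
    with i , desc , a≤i , i<b ← go k (inject₁ b) (below (suc k) b b≡)
                                     (ℕₚ.≤-<-trans (ℕₚ.≮⇒≥ ¬desc) πb<πa)
    = i , desc , a≤i , ℕₚ.<-trans i<b (Finₚ.≤̄⇒inject₁< Finₚ.≤-refl)

Grassmannian⇒¬Contains321 : (π : Vec (Fin n) n) → Grassmannian π → ¬ Contains321 π
Grassmannian⇒¬Contains321 π grass (a , b , c , a<b , b<c , πb<πa , πc<πb)
  with i , desc , _ , i<b ← descent-between π a<b πb<πa
     | j , desc′ , b≤j , _ ← descent-between π b<c πc<πb
  with refl ← grass i j desc desc′ = ℕₚ.<⇒≱ i<b b≤j

Grassmannian⇒¬Contains2143 : (π : Vec (Fin n) n) → Grassmannian π → ¬ Contains2143 π
Grassmannian⇒¬Contains2143 π grass (a , b , c , d , a<b , b<c , c<d , πb<πa , _ , πd<πc)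
  with i , desc , _ , i<b ← descent-between π a<b πb<πa
     | j , desc′ , c≤j , _ ← descent-between π c<d πd<πc
  with refl ← grass i j desc desc′ = ℕₚ.<⇒≱ (ℕₚ.<-trans i<b b<c) c≤j

inverse-sym : (π σ : Vec (Fin n) n) → IsPerm π → IsInverseOf π σ → IsInverseOf σ π
inverse-sym π σ π-perm π∘σ≗id a = π-perm _ _ (π∘σ≗id (lookup π a))

module _ (π σ : Vec (Fin n) n) (π-perm : IsPerm π) (π∘σ≗id : IsInverseOf π σ) where

  private
    σ∘π-<-mono : ∀ {a b} → a Fin.< b → lookup σ (lookup π a) Fin.< lookup σ (lookup π b)
    σ∘π-<-mono {a} {b} =
      subst₂ Fin._<_ (sym (inverse-sym π σ π-perm π∘σ≗id a)) (sym (inverse-sym π σ π-perm π∘σ≗id b))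

  -- 321 and 2143 are involutions: exchanging positions and values turns an occurrence
  -- in π into one in σ = π⁻¹.
  inverse-¬Contains321 : ¬ Contains321 σ → ¬ Contains321 π
  inverse-¬Contains321 σ-avoids (a , b , c , a<b , b<c , πb<πa , πc<πb) =
    σ-avoids (lookup π c , lookup π b , lookup π a , πc<πb , πb<πa , σ∘π-<-mono b<c , σ∘π-<-mono a<b)

  inverse-¬Contains2143 : ¬ Contains2143 σ → ¬ Contains2143 π
  inverse-¬Contains2143 σ-avoids (a , b , c , d , a<b , b<c , c<d , πb<πa , πa<πd , πd<πc) =
    σ-avoids (lookup π b , lookup π a , lookup π d , lookup π c , πb<πa , πa<πd , πd<πc ,
              σ∘π-<-mono a<b , σ∘π-<-mono b<c , σ∘π-<-mono c<d)

InGUnion⇒InAvoid : (π : Vec (Fin n) n) → InGUnion π → InAvoid π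
InGUnion⇒InAvoid π (inj₁ (π-perm , grass)) =
  π-perm , Grassmannian⇒¬Contains321 π grass , Grassmannian⇒¬Contains2143 π grass
InGUnion⇒InAvoid π (inj₂ (π-perm , σ , (_ , grass) , π∘σ≗id)) =
  π-perm , inverse-¬Contains321 π σ π-perm π∘σ≗id (Grassmannian⇒¬Contains321 σ grass)
         , inverse-¬Contains2143 π σ π-perm π∘σ≗id (Grassmannian⇒¬Contains2143 σ grass)

lookup-extensionality : {A : Set} {u v : Vec A n} → (∀ i → lookup u i ≡ lookup v i) → u ≡ v
lookup-extensionality {u = u} {v} u≗v =
  trans (sym (tabulate∘lookup u)) (trans (tabulate-cong u≗v) (tabulate∘lookup v))

lookup-surjective : (π : Vec (Fin n) n) → IsPerm π → ∀ v → ∃[ i ] lookup π i ≡ v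
lookup-surjective {suc n} π π-perm v with any? (λ i → lookup π i Fin.≟ v)
... | yes hit = hit
... | no miss = ⊥-elim (ℕₚ.1+n≰n (Finₚ.injective⇒≤ skip-v-injective))
  where
  skip-v : Fin (suc n) → Fin n
  skip-v i = punchOut (λ v≡πi → miss (i , sym v≡πi))
  skip-v-injective : ∀ {i j} → skip-v i ≡ skip-v j → i ≡ j
  skip-v-injective {i} {j} =
    π-perm i j ∘ Finₚ.punchOut-injective (λ v≡πi → miss (i , sym v≡πi)) (λ v≡πj → miss (j , sym v≡πj))

-- The junk value v is returned only when π misses v, which a permutation never does.
preimage : Vec (Fin n) n → Fin n → Fin n
preimage π v with any? (λ i → lookup π i Fin.≟ v)
... | yes (i , _) = i
... | no _ = v

lookup-preimage : (π : Vec (Fin n) n) → IsPerm π → ∀ v → lookup π (preimage π v) ≡ v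
lookup-preimage π π-perm v with any? (λ i → lookup π i Fin.≟ v)
... | yes (_ , πi≡v) = πi≡v
... | no miss = ⊥-elim (miss (lookup-surjective π π-perm v))

inverse : Vec (Fin n) n → Vec (Fin n) n
inverse π = tabulate (preimage π)

inverse-isInverse : (π : Vec (Fin n) n) → IsPerm π → IsInverseOf π (inverse π)
inverse-isInverse π π-perm v =
  trans (cong (lookup π) (lookup∘tabulate (preimage π) v)) (lookup-preimage π π-perm v)

inverse-isPerm : (π : Vec (Fin n) n) → IsPerm π → IsPerm (inverse π)
inverse-isPerm π π-perm u v eq =
  trans (sym (inverse-isInverse π π-perm u)) (trans (cong (lookup π) eq) (inverse-isInverse π π-perm v))

inverse-involutive : (π : Vec (Fin n) n) → IsPerm π → inverse (inverse π) ≡ π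
inverse-involutive π π-perm = lookup-extensionality λ a →
  inverse-isPerm π π-perm _ _ (trans (inverse-isInverse (inverse π) (inverse-isPerm π π-perm) a)
                                     (sym (inverse-sym π (inverse π) π-perm (inverse-isInverse π π-perm) a)))

-- Equivalently, π⁻¹ has a descent at u.
InverseDescent : Vec (Fin n) n → ℕ → Set
InverseDescent {n} π u = ∃[ p ] ∃[ q ] p Fin.< q × π ! p ≡ suc u × π ! q ≡ u

descent-inverse⇒InverseDescent : (π : Vec (Fin n) n) → IsPerm π →
                                 ∀ v → DescentAt (inverse π) v → InverseDescent π (toℕ v)
descent-inverse⇒InverseDescent π π-perm v (v′ , v′≡ , desc) =
  lookup (inverse π) v′ , lookup (inverse π) v , desc ,
  trans (cong toℕ (inverse-isInverse π π-perm v′)) v′≡ , cong toℕ (inverse-isInverse π π-perm v)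

module Avoiding (π : Vec (Fin n) n) (π-perm : IsPerm π)
                (¬321 : ¬ Contains321 π) (¬2143 : ¬ Contains2143 π) where

  values-distinct : ∀ {a b} → a Fin.< b → π ! a ≢ π ! b
  values-distinct a<b πa≡πb = ℕₚ.<-irrefl (cong toℕ (π-perm _ _ (toℕ-injective πa≡πb))) a<b

  module Straddle {i j p q : Fin n} {u : ℕ}
                  (j≡ : toℕ j ≡ suc (toℕ i)) (πj<πi : π ! j ℕ.< π ! i)
                  (p<q : p Fin.< q) (πp≡ : π ! p ≡ suc u) (πq≡ : π ! q ≡ u) where

    i<j : i Fin.< j
    i<j = subst (toℕ i ℕ.<_) (sym j≡) (ℕₚ.n<1+n (toℕ i))

    πq<πp : π ! q ℕ.< π ! p
    πq<πp = subst₂ ℕ._<_ (sym πq≡) (sym πp≡) (ℕₚ.n<1+n u)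

    above-πp : ∀ {a} → u ℕ.< π ! a → π ! p ≢ π ! a → π ! p ℕ.< π ! a
    above-πp u<πa πp≢πa = ℕₚ.≤∧≢⇒< (subst (ℕ._≤ _) (sym πp≡) u<πa) πp≢πa

    p≤i : toℕ p ℕ.≤ toℕ i
    p≤i = ℕₚ.≮⇒≥ i≮p
      where
      i≮p : ¬ i Fin.< p
      i≮p i<p with ℕₚ.m≤n⇒m<n∨m≡n (subst (ℕ._≤ toℕ p) (sym j≡) i<p)
      ... | inj₂ j≡p = ¬321 (i , j , q , i<j , subst (ℕ._< toℕ q) (sym j≡p) p<q , πj<πi ,
                             subst (λ c → π ! q ℕ.< π ! c) (sym (toℕ-injective j≡p)) πq<πp)
      ... | inj₁ j<p with ℕₚ.<-cmp (π ! i) u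
      ...   | tri< πi<u _ _ =
        ¬2143 (i , j , p , q , i<j , j<p , p<q , πj<πi , subst (π ! i ℕ.<_) (sym πq≡) πi<u , πq<πp)
      ...   | tri≈ _ πi≡u _ = values-distinct (ℕₚ.<-trans i<p p<q) (trans πi≡u (sym πq≡))
      ...   | tri> _ _ u<πi =
        ¬321 (i , p , q , i<p , p<q , above-πp u<πi (values-distinct i<p ∘ sym) , πq<πp)

    i<q : i Fin.< q
    i<q = ℕₚ.≰⇒> q≰i
      where
      q≰i : ¬ toℕ q ℕ.≤ toℕ i
      q≰i q≤i with ℕₚ.m≤n⇒m<n∨m≡n q≤i
      ... | inj₂ q≡i = ¬321 (p , i , j , subst (toℕ p ℕ.<_) q≡i p<q , i<j ,
                             subst (λ c → π ! c ℕ.< π ! p) (toℕ-injective q≡i) πq<πp , πj<πi)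
      ... | inj₁ q<i with ℕₚ.<-cmp (π ! j) u
      ...   | tri< πj<u _ _ =
        ¬321 (p , q , j , p<q , ℕₚ.<-trans q<i i<j , πq<πp , subst (π ! j ℕ.<_) (sym πq≡) πj<u)
      ...   | tri≈ _ πj≡u _ = values-distinct (ℕₚ.<-trans q<i i<j) (trans πq≡ (sym πj≡u))
      ...   | tri> _ _ u<πj =
        ¬2143 (p , q , i , j , p<q , q<i , i<j , πq<πp ,
               above-πp u<πj (values-distinct (ℕₚ.<-trans p<q (ℕₚ.<-trans q<i i<j))) , πj<πi)

    πj≤u : π ! j ℕ.≤ u
    πj≤u = ℕₚ.≮⇒≥ λ u<πj →
      ¬321 (i , j , q , i<j , j<q u<πj , πj<πi , subst (ℕ._< π ! j) (sym πq≡) u<πj)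
      where
      j<q : u ℕ.< π ! j → j Fin.< q
      j<q u<πj = ℕₚ.≤∧≢⇒< (subst (ℕ._≤ toℕ q) (sym j≡) i<q)
                   (λ j≡q → ℕₚ.<-irrefl (sym (trans (cong (π !_) (toℕ-injective j≡q)) πq≡)) u<πj)

    u<πi : u ℕ.< π ! i
    u<πi = ℕₚ.≰⇒> λ πi≤u →
      ¬321 (p , i , j , p<i πi≤u , i<j , subst (π ! i ℕ.<_) (sym πp≡) (s≤s πi≤u) , πj<πi)
      where
      p<i : π ! i ℕ.≤ u → p Fin.< i
      p<i πi≤u = ℕₚ.≤∧≢⇒< p≤i λ p≡i →
        ℕₚ.<-irrefl refl (subst (ℕ._≤ u) (trans (cong (π !_) (sym (toℕ-injective p≡i))) πp≡) πi≤u)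

  -- Adjacent descents, or w = u + 1, give a 321; otherwise p, i + 1, i′, q′ form a 2143.
  ordered-descents-inverseDescents-⊥ : ∀ {i i′ u w} → DescentAt π i → DescentAt π i′ → i Fin.< i′ →
                                       InverseDescent π u → InverseDescent π w → u ℕ.< w → ⊥
  ordered-descents-inverseDescents-⊥ {i} {i′} {u} {w} (j , j≡ , πj<πi) (j′ , j′≡ , πj′<πi′) i<i′
      (p , q , p<q , πp≡ , πq≡) (p′ , q′ , p′<q′ , πp′≡ , πq′≡) u<w =
    cases (ℕₚ.m≤n⇒m<n∨m≡n (subst (ℕ._≤ toℕ i′) (sym j≡) i<i′)) (w ℕ.≟ suc u)
    where
    module S = Straddle j≡ πj<πi p<q πp≡ πq≡
    module S′ = Straddle j′≡ πj′<πi′ p′<q′ πp′≡ πq′≡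
    cases : j Fin.< i′ ⊎ toℕ j ≡ toℕ i′ → Dec (w ≡ suc u) → ⊥
    cases (inj₂ j≡i′) _ =
      ¬321 (i , j , j′ , S.i<j , subst (ℕ._< toℕ j′) (sym j≡i′) S′.i<j , πj<πi ,
            subst (λ c → π ! j′ ℕ.< π ! c) (sym (toℕ-injective j≡i′)) πj′<πi′)
    cases (inj₁ j<i′) (yes w≡1+u) =
      ¬321 (p′ , p , q , subst (toℕ p′ ℕ.<_) (cong toℕ q′≡p) p′<q′ , p<q ,
            subst (λ c → π ! c ℕ.< π ! p′) q′≡p S′.πq<πp , S.πq<πp)
      where
      q′≡p : q′ ≡ p
      q′≡p = π-perm q′ p (toℕ-injective (trans πq′≡ (trans w≡1+u (sym πp≡))))
    cases (inj₁ j<i′) (no w≢1+u) =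
      ¬2143 (p , j , i′ , q′ , ℕₚ.≤-<-trans S.p≤i S.i<j , j<i′ , S′.i<q ,
             subst (π ! j ℕ.<_) (sym πp≡) (s≤s S.πj≤u) ,
             subst₂ ℕ._<_ (sym πp≡) (sym πq′≡) (ℕₚ.≤∧≢⇒< u<w (w≢1+u ∘ sym)) ,
             subst (ℕ._< π ! i′) (sym πq′≡) S′.u<πi)

  twoDescents⇒inverseDescent-unique : ∀ {i i′ u w} → DescentAt π i → DescentAt π i′ → i ≢ i′ →
                                      InverseDescent π u → InverseDescent π w → u ≡ w
  twoDescents⇒inverseDescent-unique {i} {i′} {u} {w} dᵢ dᵢ′ i≢i′ Iᵤ Iw
    with Finₚ.<-cmp i i′ | ℕₚ.<-cmp u w
  ... | tri≈ _ i≡i′ _ | _            = ⊥-elim (i≢i′ i≡i′)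
  ... | _             | tri≈ _ u≡w _ = u≡w
  ... | tri< i<i′ _ _ | tri< u<w _ _ = ⊥-elim (ordered-descents-inverseDescents-⊥ dᵢ dᵢ′ i<i′ Iᵤ Iw u<w)
  ... | tri< i<i′ _ _ | tri> _ _ w<u = ⊥-elim (ordered-descents-inverseDescents-⊥ dᵢ dᵢ′ i<i′ Iw Iᵤ w<u)
  ... | tri> _ _ i′<i | tri< u<w _ _ = ⊥-elim (ordered-descents-inverseDescents-⊥ dᵢ′ dᵢ i′<i Iᵤ Iw u<w)
  ... | tri> _ _ i′<i | tri> _ _ w<u = ⊥-elim (ordered-descents-inverseDescents-⊥ dᵢ′ dᵢ i′<i Iw Iᵤ w<u)

descent? : (π : Vec (Fin n) n) (i : Fin n) → Dec (DescentAt π i)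
descent? π i = any? λ j → (toℕ j ℕ.≟ suc (toℕ i)) ×-dec (lookup π j Fin.<? lookup π i)

TwoDescents : Vec (Fin n) n → Set
TwoDescents {n} π = ∃[ i ] ∃[ i′ ] DescentAt π i × DescentAt π i′ × i ≢ i′

twoDescents? : (π : Vec (Fin n) n) → Dec (TwoDescents π)
twoDescents? π = any? λ i → any? λ i′ → descent? π i ×-dec descent? π i′ ×-dec ¬? (i Fin.≟ i′)

¬TwoDescents⇒Grassmannian : (π : Vec (Fin n) n) → ¬ TwoDescents π → Grassmannian π
¬TwoDescents⇒Grassmannian π ¬two i i′ dᵢ dᵢ′ with i Fin.≟ i′
... | yes i≡i′ = i≡i′
... | no i≢i′ = ⊥-elim (¬two (i , i′ , dᵢ , dᵢ′ , i≢i′))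

InAvoid⇒InGUnion : (π : Vec (Fin n) n) → InAvoid π → InGUnion π
InAvoid⇒InGUnion π (π-perm , ¬321 , ¬2143) with twoDescents? π
... | no ¬two = inj₁ (π-perm , ¬TwoDescents⇒Grassmannian π ¬two)
... | yes (i , i′ , dᵢ , dᵢ′ , i≢i′) =
  inj₂ (π-perm , inverse π , (inverse-isPerm π π-perm , grassmannian⁻¹) , inverse-isInverse π π-perm)
  where
  open Avoiding π π-perm ¬321 ¬2143
  grassmannian⁻¹ : Grassmannian (inverse π)
  grassmannian⁻¹ v v′ d d′ = toℕ-injective (twoDescents⇒inverseDescent-unique dᵢ dᵢ′ i≢i′
    (descent-inverse⇒InverseDescent π π-perm v d) (descent-inverse⇒InverseDescent π π-perm v′ d′))

toℕ-punchIn-< : ∀ {m} (v : Fin (suc m)) (x : Fin m) → toℕ x ℕ.< toℕ v → toℕ (punchIn v x) ≡ toℕ x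
toℕ-punchIn-< (suc v) zero    _         = refl
toℕ-punchIn-< (suc v) (suc x) (s≤s x<v) = cong suc (toℕ-punchIn-< v x x<v)

toℕ-punchIn-≥ : ∀ {m} (v : Fin (suc m)) (x : Fin m) → toℕ v ℕ.≤ toℕ x →
                toℕ (punchIn v x) ≡ suc (toℕ x)
toℕ-punchIn-≥ zero    x       _         = refl
toℕ-punchIn-≥ (suc v) (suc x) (s≤s v≤x) = cong suc (toℕ-punchIn-≥ v x v≤x)

punchIn-mono-< : ∀ {m} (v : Fin (suc m)) {x y : Fin m} → x Fin.< y → punchIn v x Fin.< punchIn v y
punchIn-mono-< v {x} {y} x<y = ℕₚ.≰⇒> λ py≤px → ℕₚ.<⇒≱ x<y (Finₚ.punchIn-cancel-≤ v y x py≤px)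

trues : Vec Bool n → ℕ
trues []          = 0
trues (true ∷ w)  = suc (trues w)
trues (false ∷ w) = trues w

truesFin : Vec Bool n → Fin (suc n)
truesFin []          = zero
truesFin (true ∷ w)  = suc (truesFin w)
truesFin (false ∷ w) = inject₁ (truesFin w)

toℕ-truesFin : (w : Vec Bool n) → toℕ (truesFin w) ≡ trues w
toℕ-truesFin []          = refl
toℕ-truesFin (true ∷ w)  = cong suc (toℕ-truesFin w)
toℕ-truesFin (false ∷ w) = trans (toℕ-inject₁ (truesFin w)) (toℕ-truesFin w)

-- shuffle w sends the positions marked true, left to right, to 0, 1, …, trues w ∸ 1 and the
-- positions marked false, left to right, to the remaining values: the head gets its value
-- from its mark, and the shuffle of the tail is renumbered around that value by punchIn.
firstValue : Bool → Vec Bool n → Fin (suc n)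
firstValue true  _ = zero
firstValue false w = truesFin w

shuffleAt : Vec Bool n → Fin n → Fin n
shuffleAt (b ∷ w) zero    = firstValue b w
shuffleAt (b ∷ w) (suc i) = punchIn (firstValue b w) (shuffleAt w i)

shuffle : Vec Bool n → Vec (Fin n) n
shuffle w = tabulate (shuffleAt w)

shuffleAt-true : (w : Vec Bool n) (i : Fin n) → lookup w i ≡ true → toℕ (shuffleAt w i) ℕ.< trues w
shuffleAt-true (true ∷ w)  zero    _  = s≤s z≤n
shuffleAt-true (true ∷ w)  (suc i) wᵢ = s≤s (shuffleAt-true w i wᵢ)
shuffleAt-true (false ∷ w) (suc i) wᵢ =
  subst (ℕ._< trues w) (sym (toℕ-punchIn-< (truesFin w) (shuffleAt w i) low′)) low
  where
  low : toℕ (shuffleAt w i) ℕ.< trues w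
  low = shuffleAt-true w i wᵢ
  low′ : toℕ (shuffleAt w i) ℕ.< toℕ (truesFin w)
  low′ = subst (toℕ (shuffleAt w i) ℕ.<_) (sym (toℕ-truesFin w)) low

shuffleAt-false : (w : Vec Bool n) (i : Fin n) → lookup w i ≡ false → trues w ℕ.≤ toℕ (shuffleAt w i)
shuffleAt-false (true ∷ w)  (suc i) wᵢ = s≤s (shuffleAt-false w i wᵢ)
shuffleAt-false (false ∷ w) zero    _  = ℕₚ.≤-reflexive (sym (toℕ-truesFin w))
shuffleAt-false (false ∷ w) (suc i) wᵢ =
  subst (trues w ℕ.≤_) (sym (toℕ-punchIn-≥ (truesFin w) (shuffleAt w i) high′)) (ℕₚ.m≤n⇒m≤1+n high)
  where
  high : trues w ℕ.≤ toℕ (shuffleAt w i)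
  high = shuffleAt-false w i wᵢ
  high′ : toℕ (truesFin w) ℕ.≤ toℕ (shuffleAt w i)
  high′ = subst (ℕ._≤ toℕ (shuffleAt w i)) (sym (toℕ-truesFin w)) high

shuffleAt-false-true : (w : Vec Bool n) {i j : Fin n} → lookup w i ≡ false → lookup w j ≡ true →
                       shuffleAt w j Fin.< shuffleAt w i
shuffleAt-false-true w {i} {j} wᵢ wⱼ = ℕₚ.<-≤-trans (shuffleAt-true w j wⱼ) (shuffleAt-false w i wᵢ)

shuffleAt-mono : (w : Vec Bool n) {i j : Fin n} → i Fin.< j → lookup w i ≡ lookup w j →
                 shuffleAt w i Fin.< shuffleAt w j
shuffleAt-mono (true ∷ w)  {zero}  {suc j} _         _  = s≤s z≤n
shuffleAt-mono (false ∷ w) {zero}  {suc j} _         wⱼ =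
  subst₂ ℕ._<_ (sym (toℕ-truesFin w)) (sym (toℕ-punchIn-≥ (truesFin w) (shuffleAt w j) high′)) (s≤s high)
  where
  high : trues w ℕ.≤ toℕ (shuffleAt w j)
  high = shuffleAt-false w j (sym wⱼ)
  high′ : toℕ (truesFin w) ℕ.≤ toℕ (shuffleAt w j)
  high′ = subst (ℕ._≤ toℕ (shuffleAt w j)) (sym (toℕ-truesFin w)) high
shuffleAt-mono (b ∷ w)     {suc i} {suc j} (s≤s i<j) wᵢ≡wⱼ =
  punchIn-mono-< (firstValue b w) (shuffleAt-mono w i<j wᵢ≡wⱼ)

shuffleAt-<-cases : (w : Vec Bool n) {i j : Fin n} → i Fin.< j →
                    (lookup w i ≡ false × lookup w j ≡ true) ⊎ shuffleAt w i Fin.< shuffleAt w j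
shuffleAt-<-cases w {i} {j} i<j with lookup w i in wᵢ | lookup w j in wⱼ
... | true  | true  = inj₂ (shuffleAt-mono w i<j (trans wᵢ (sym wⱼ)))
... | true  | false = inj₂ (shuffleAt-false-true w wⱼ wᵢ)
... | false | true  = inj₁ (refl , refl)
... | false | false = inj₂ (shuffleAt-mono w i<j (trans wᵢ (sym wⱼ)))

shuffleAt-<⇒≢ : (w : Vec Bool n) {i j : Fin n} → i Fin.< j → shuffleAt w i ≢ shuffleAt w j
shuffleAt-<⇒≢ w i<j eq with shuffleAt-<-cases w i<j
... | inj₁ (wᵢ , wⱼ) = ℕₚ.<-irrefl (cong toℕ (sym eq)) (shuffleAt-false-true w wᵢ wⱼ)
... | inj₂ lt        = ℕₚ.<-irrefl (cong toℕ eq) lt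

shuffleAt-injective : (w : Vec Bool n) {i j : Fin n} → shuffleAt w i ≡ shuffleAt w j → i ≡ j
shuffleAt-injective w {i} {j} eq with Finₚ.<-cmp i j
... | tri< i<j _ _ = ⊥-elim (shuffleAt-<⇒≢ w i<j eq)
... | tri≈ _ i≡j _ = i≡j
... | tri> _ _ j<i = ⊥-elim (shuffleAt-<⇒≢ w j<i (sym eq))

lookup-shuffle : (w : Vec Bool n) (i : Fin n) → lookup (shuffle w) i ≡ shuffleAt w i
lookup-shuffle w = lookup∘tabulate (shuffleAt w)

shuffle-isPerm : (w : Vec Bool n) → IsPerm (shuffle w)
shuffle-isPerm w i j eq =
  shuffleAt-injective w (trans (sym (lookup-shuffle w i)) (trans eq (lookup-shuffle w j)))

AscentAt : Vec Bool n → Fin n → Set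
AscentAt {n} w i = ∃[ j ] toℕ j ≡ suc (toℕ i) × lookup w i ≡ false × lookup w j ≡ true

-- The clause order makes ascents (true ∷ w) reduce to ascents w and ascents (false ∷ false ∷ w)
-- to ascents (false ∷ w), on which the counting below relies.
ascents : Vec Bool n → ℕ
ascents (false ∷ true ∷ w) = suc (ascents (true ∷ w))
ascents (_ ∷ w)            = ascents w
ascents []                 = 0

ascentAt-suc : ∀ b {w : Vec Bool n} {i} → AscentAt w i → AscentAt (b ∷ w) (suc i)
ascentAt-suc b (j , j≡ , wᵢ , wⱼ) = suc j , cong suc j≡ , wᵢ , wⱼ

ascentAt-suc⁻ : ∀ {b} {w : Vec Bool n} {i} → AscentAt (b ∷ w) (suc i) → AscentAt w i
ascentAt-suc⁻ (suc j , j≡ , wᵢ , wⱼ) = j , ℕₚ.suc-injective j≡ , wᵢ , wⱼ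

ascentAt-zero⁻ : ∀ {b c} {w : Vec Bool n} → AscentAt (b ∷ c ∷ w) zero → b ≡ false × c ≡ true
ascentAt-zero⁻ (suc zero , _ , b≡ , c≡) = b≡ , c≡

ascents-∷ : ∀ b (w : Vec Bool n) → ascents w ℕ.≤ ascents (b ∷ w)
ascents-∷ true  w           = ℕₚ.≤-refl
ascents-∷ false []          = ℕₚ.≤-refl
ascents-∷ false (true ∷ w)  = ℕₚ.n≤1+n _
ascents-∷ false (false ∷ w) = ℕₚ.≤-refl

ascentAt⇒1≤ascents : (w : Vec Bool n) {i : Fin n} → AscentAt w i → 1 ℕ.≤ ascents w
ascentAt⇒1≤ascents (b ∷ [])    {zero} (zero , () , _)
ascentAt⇒1≤ascents (b ∷ c ∷ w) {zero} a with ascentAt-zero⁻ a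
... | refl , refl = s≤s z≤n
ascentAt⇒1≤ascents (b ∷ w) {suc i} a =
  ℕₚ.≤-trans (ascentAt⇒1≤ascents w (ascentAt-suc⁻ a)) (ascents-∷ b w)

twoAscents⇒2≤ascents : (w : Vec Bool n) {i i′ : Fin n} → AscentAt w i → AscentAt w i′ → i ≢ i′ →
                       2 ℕ.≤ ascents w
twoAscents⇒2≤ascents (b ∷ w)     {zero}  {zero}   _ _  i≢i′ = ⊥-elim (i≢i′ refl)
twoAscents⇒2≤ascents (b ∷ c ∷ w) {zero}  {suc i′} a a′ _ with ascentAt-zero⁻ a
... | refl , refl = s≤s (ascentAt⇒1≤ascents (true ∷ w) (ascentAt-suc⁻ a′))
twoAscents⇒2≤ascents (b ∷ c ∷ w) {suc i} {zero}   a a′ _ with ascentAt-zero⁻ a′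
... | refl , refl = s≤s (ascentAt⇒1≤ascents (true ∷ w) (ascentAt-suc⁻ a))
twoAscents⇒2≤ascents (b ∷ w)     {suc i} {suc i′} a a′ i≢i′ =
  ℕₚ.≤-trans (twoAscents⇒2≤ascents w (ascentAt-suc⁻ a) (ascentAt-suc⁻ a′) (i≢i′ ∘ cong suc))
             (ascents-∷ b w)

1≤ascents⇒ascentAt : (w : Vec Bool n) → 1 ℕ.≤ ascents w → ∃[ i ] AscentAt w i
1≤ascents⇒ascentAt (false ∷ true ∷ w)  _ = zero , suc zero , refl , refl , refl
1≤ascents⇒ascentAt (false ∷ false ∷ w) 1≤ with i , a ← 1≤ascents⇒ascentAt (false ∷ w) 1≤ =
  suc i , ascentAt-suc false a
1≤ascents⇒ascentAt (true ∷ w)          1≤ with i , a ← 1≤ascents⇒ascentAt w 1≤ =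
  suc i , ascentAt-suc true a

2≤ascents⇒twoAscents : (w : Vec Bool n) → 2 ℕ.≤ ascents w →
                       ∃[ i ] ∃[ i′ ] AscentAt w i × AscentAt w i′ × i ≢ i′
2≤ascents⇒twoAscents (false ∷ true ∷ w) (s≤s 1≤) with i , a ← 1≤ascents⇒ascentAt (true ∷ w) 1≤ =
  zero , suc i , (suc zero , refl , refl , refl) , ascentAt-suc false a , λ ()
2≤ascents⇒twoAscents (false ∷ false ∷ w) 2≤
  with i , i′ , a , a′ , i≢i′ ← 2≤ascents⇒twoAscents (false ∷ w) 2≤ =
  suc i , suc i′ , ascentAt-suc false a , ascentAt-suc false a′ , i≢i′ ∘ Finₚ.suc-injective
2≤ascents⇒twoAscents (true ∷ w) 2≤ with i , i′ , a , a′ , i≢i′ ← 2≤ascents⇒twoAscents w 2≤ =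
  suc i , suc i′ , ascentAt-suc true a , ascentAt-suc true a′ , i≢i′ ∘ Finₚ.suc-injective

strictlyIncreasing⇒≗id : (f : Fin n → Fin n) → (∀ {i j} → i Fin.< j → f i Fin.< f j) → ∀ i → f i ≡ i
strictlyIncreasing⇒≗id {suc m} f f-mono i = toℕ-injective (ℕₚ.≤-antisym fi≤i i≤fi)
  where
  spread : ∀ k (i j : Fin (suc m)) → toℕ j ≡ k + toℕ i → toℕ (f i) + k ℕ.≤ toℕ (f j)
  spread zero    i j       j≡ =
    ℕₚ.≤-reflexive (trans (ℕₚ.+-identityʳ _) (cong (toℕ ∘ f) (toℕ-injective (sym j≡))))
  spread (suc k) i (suc j) j≡ =
    subst (ℕ._≤ toℕ (f (suc j))) (sym (ℕₚ.+-suc (toℕ (f i)) k))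
      (ℕₚ.≤-<-trans (spread k i (inject₁ j) (trans (toℕ-inject₁ j) (ℕₚ.suc-injective j≡)))
                    (f-mono (Finₚ.≤̄⇒inject₁< ℕₚ.≤-refl)))
  i≤m : toℕ i ℕ.≤ m
  i≤m = ℕₚ.≤-pred (Finₚ.toℕ<n i)
  i≤fi : toℕ i ℕ.≤ toℕ (f i)
  i≤fi = ℕₚ.≤-trans (ℕₚ.m≤n+m (toℕ i) _) (spread (toℕ i) zero i (sym (ℕₚ.+-identityʳ (toℕ i))))
  fi≤i : toℕ (f i) ℕ.≤ toℕ i
  fi≤i = ℕₚ.+-cancelʳ-≤ (m ∸ toℕ i) (toℕ (f i)) (toℕ i) (begin
    toℕ (f i) + (m ∸ toℕ i) ≤⟨ spread (m ∸ toℕ i) i last last≡ ⟩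
    toℕ (f last)            ≤⟨ ℕₚ.≤-pred (Finₚ.toℕ<n (f last)) ⟩
    m                       ≡⟨ sym (ℕₚ.m+[n∸m]≡n i≤m) ⟩
    toℕ i + (m ∸ toℕ i)     ∎)
    where
    open ℕₚ.≤-Reasoning
    last : Fin (suc m)
    last = Fin.fromℕ m
    last≡ : toℕ last ≡ (m ∸ toℕ i) + toℕ i
    last≡ = trans (Finₚ.toℕ-fromℕ m) (sym (ℕₚ.m∸n+n≡m i≤m))

noDescent⇒≡allFin : (π : Vec (Fin n) n) → IsPerm π → (∀ i → ¬ DescentAt π i) → π ≡ allFin n
noDescent⇒≡allFin π π-perm ¬desc =
  lookup-extensionality λ i → trans (strictlyIncreasing⇒≗id (lookup π) mono i) (sym (lookup-allFin i))
  where
  mono : ∀ {i j} → i Fin.< j → lookup π i Fin.< lookup π j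
  mono {i} {j} i<j with ℕₚ.<-cmp (π ! i) (π ! j)
  ... | tri< πi<πj _ _ = πi<πj
  ... | tri≈ _ πi≡πj _ = ⊥-elim (ℕₚ.<-irrefl (cong toℕ (π-perm i j (toℕ-injective πi≡πj))) i<j)
  ... | tri> _ _ πj<πi = ⊥-elim (¬desc _ (proj₁ (proj₂ (descent-between π i<j πj<πi))))

shuffle-! : (w : Vec Bool n) (i : Fin n) → shuffle w ! i ≡ toℕ (shuffleAt w i)
shuffle-! w i = cong toℕ (lookup-shuffle w i)

descent-shuffle⇒ascentAt : (w : Vec Bool n) {i : Fin n} → DescentAt (shuffle w) i → AscentAt w i
descent-shuffle⇒ascentAt w {i} (j , j≡ , desc)
  with shuffleAt-<-cases w (subst (toℕ i ℕ.<_) (sym j≡) (ℕₚ.n<1+n (toℕ i)))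
... | inj₁ (wᵢ , wⱼ) = j , j≡ , wᵢ , wⱼ
... | inj₂ asc = ⊥-elim (ℕₚ.<-asym asc (subst₂ ℕ._<_ (shuffle-! w j) (shuffle-! w i) desc))

ascentAt⇒descent-shuffle : (w : Vec Bool n) {i : Fin n} → AscentAt w i → DescentAt (shuffle w) i
ascentAt⇒descent-shuffle w {i} (j , j≡ , wᵢ , wⱼ) =
  j , j≡ , subst₂ ℕ._<_ (sym (shuffle-! w j)) (sym (shuffle-! w i)) (shuffleAt-false-true w wᵢ wⱼ)

inverseDescent-shuffle : (w : Vec Bool n) {u : ℕ} → InverseDescent (shuffle w) u → suc u ≡ trues w
inverseDescent-shuffle w {u} (p , q , p<q , πp≡ , πq≡) with shuffleAt-<-cases w p<q
... | inj₁ (wₚ , w_q) = ℕₚ.≤-antisym (subst (ℕ._< trues w) shuffleAt-q≡ (shuffleAt-true w q w_q))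
                                     (subst (trues w ℕ.≤_) shuffleAt-p≡ (shuffleAt-false w p wₚ))
  where
  shuffleAt-p≡ : toℕ (shuffleAt w p) ≡ suc u
  shuffleAt-p≡ = trans (sym (shuffle-! w p)) πp≡
  shuffleAt-q≡ : toℕ (shuffleAt w q) ≡ u
  shuffleAt-q≡ = trans (sym (shuffle-! w q)) πq≡
... | inj₂ asc =
  ⊥-elim (ℕₚ.<-asym (subst₂ ℕ._<_ πp≡ πq≡ (subst₂ ℕ._<_ (sym (shuffle-! w p)) (sym (shuffle-! w q)) asc))
                    (ℕₚ.n<1+n u))

inverse-shuffle-isGrassmannian : (w : Vec Bool n) → InG (inverse (shuffle w))
inverse-shuffle-isGrassmannian w = inverse-isPerm (shuffle w) (shuffle-isPerm w) , λ v v′ d d′ →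
  toℕ-injective (ℕₚ.suc-injective (trans (boundary v d) (sym (boundary v′ d′))))
  where
  boundary : ∀ v → DescentAt (inverse (shuffle w)) v → suc (toℕ v) ≡ trues w
  boundary v d = inverseDescent-shuffle w (descent-inverse⇒InverseDescent (shuffle w) (shuffle-isPerm w) v d)

allFin-¬descent : (i : Fin n) → ¬ DescentAt (allFin n) i
allFin-¬descent i (j , j≡ , desc) =
  ℕₚ.<-asym (subst₂ ℕ._<_ (cong toℕ (lookup-allFin j)) (cong toℕ (lookup-allFin i)) desc)
            (subst (toℕ i ℕ.<_) (sym j≡) (ℕₚ.n<1+n (toℕ i)))

inverse≡allFin⇒≡allFin : (π : Vec (Fin n) n) → IsPerm π → inverse π ≡ allFin n → π ≡ allFin n
inverse≡allFin⇒≡allFin π π-perm eq = lookup-extensionality λ v → begin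
  lookup π v                         ≡⟨ cong (lookup π) (sym (lookup-allFin v)) ⟩
  lookup π (lookup (allFin _) v)     ≡⟨ cong (λ σ → lookup π (lookup σ v)) (sym eq) ⟩
  lookup π (lookup (inverse π) v)    ≡⟨ inverse-isInverse π π-perm v ⟩
  v                                  ≡⟨ sym (lookup-allFin v) ⟩
  lookup (allFin _) v                ∎
  where open ≡-Reasoning

-- An ascent makes shuffle w, hence its inverse, differ from the identity, so the inverse has a descent.
ascentAt⇒inverseDescent-shuffle : (w : Vec Bool n) {i : Fin n} → AscentAt w i →
                                  ∃[ u ] InverseDescent (shuffle w) u
ascentAt⇒inverseDescent-shuffle {n} w {i} a with any? (descent? (inverse (shuffle w)))
... | yes (v , d) = toℕ v , descent-inverse⇒InverseDescent (shuffle w) (shuffle-isPerm w) v d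
... | no ¬d =
  ⊥-elim (allFin-¬descent i (subst (λ π → DescentAt π i) shuffle≡allFin (ascentAt⇒descent-shuffle w a)))
  where
  shuffle≡allFin : shuffle w ≡ allFin n
  shuffle≡allFin = inverse≡allFin⇒≡allFin (shuffle w) (shuffle-isPerm w)
    (noDescent⇒≡allFin (inverse (shuffle w)) (inverse-isPerm (shuffle w) (shuffle-isPerm w)) λ v d → ¬d (v , d))

shuffle-injective : (w w′ : Vec Bool n) → 1 ℕ.≤ ascents w → shuffle w ≡ shuffle w′ → w ≡ w′
shuffle-injective w w′ 1≤ eq = lookup-extensionality same
  where
  boundary : ∃[ u ] InverseDescent (shuffle w) u
  boundary = ascentAt⇒inverseDescent-shuffle w (proj₂ (1≤ascents⇒ascentAt w 1≤))
  trues≡ : trues w ≡ trues w′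
  trues≡ = trans (sym (inverseDescent-shuffle w (proj₂ boundary)))
                 (inverseDescent-shuffle w′ (subst (λ π → InverseDescent π (proj₁ boundary)) eq (proj₂ boundary)))
  value≡ : ∀ i → toℕ (shuffleAt w i) ≡ toℕ (shuffleAt w′ i)
  value≡ i = trans (sym (shuffle-! w i)) (trans (cong (_! i) eq) (shuffle-! w′ i))
  same : ∀ i → lookup w i ≡ lookup w′ i
  same i with lookup w i in wᵢ | lookup w′ i in w′ᵢ
  ... | true  | true  = refl
  ... | false | false = refl
  ... | true  | false = ⊥-elim (ℕₚ.<⇒≱ (subst₂ ℕ._<_ (value≡ i) trues≡ (shuffleAt-true w i wᵢ))
                                      (shuffleAt-false w′ i w′ᵢ))
  ... | false | true  = ⊥-elim (ℕₚ.<⇒≱ (subst₂ ℕ._<_ (sym (value≡ i)) (sym trues≡)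
                                                   (shuffleAt-true w′ i w′ᵢ))
                                      (shuffleAt-false w i wᵢ))

descentBound : (π : Vec (Fin n) n) → Grassmannian π → ∃[ k ] ∀ d → DescentAt π d → suc (toℕ d) ≡ k
descentBound π grass with any? (descent? π)
... | yes (d₀ , D₀) = suc (toℕ d₀) , λ d D → cong (suc ∘ toℕ) (grass d d₀ D D₀)
... | no ¬D = 0 , λ d D → ⊥-elim (¬D (d , D))

-- A Grassmannian π with its descent at k ∸ 1 is increasing on the positions < k and on the
-- positions ≥ k, so π⁻¹ is the shuffle marking the values π takes at positions < k.
Grassmannian⇒inverse≡shuffle : (π σ : Vec (Fin n) n) → IsPerm π → Grassmannian π → IsInverseOf π σ →
                               ∃[ w ] shuffle w ≡ σ
Grassmannian⇒inverse≡shuffle {n} π σ π-perm grass π∘σ≗id = w , lookup-extensionality λ v → begin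
  lookup (shuffle w) v          ≡⟨ lookup-shuffle w v ⟩
  shuffleAt w v                 ≡⟨ cong (shuffleAt w) (sym (π∘σ≗id v)) ⟩
  h (lookup σ v)                ≡⟨ strictlyIncreasing⇒≗id h h-mono (lookup σ v) ⟩
  lookup σ v                    ∎
  where
  open ≡-Reasoning
  k : ℕ
  k = proj₁ (descentBound π grass)
  w : Vec Bool n
  w = tabulate λ v → does (toℕ (lookup σ v) ℕ.<? k)
  h : Fin n → Fin n
  h x = shuffleAt w (lookup π x)

  mark : ∀ x → lookup w (lookup π x) ≡ does (toℕ x ℕ.<? k)
  mark x = trans (lookup∘tabulate _ (lookup π x))
                 (cong (λ y → does (toℕ y ℕ.<? k)) (inverse-sym π σ π-perm π∘σ≗id x))
  marked : ∀ {x} → toℕ x ℕ.< k → lookup w (lookup π x) ≡ true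
  marked {x} x<k = trans (mark x) (dec-true (toℕ x ℕ.<? k) x<k)
  unmarked : ∀ {x} → k ℕ.≤ toℕ x → lookup w (lookup π x) ≡ false
  unmarked {x} k≤x = trans (mark x) (dec-false (toℕ x ℕ.<? k) (ℕₚ.≤⇒≯ k≤x))

  true≢false : true ≢ false
  true≢false ()

  marks-decrease-⊥ : ∀ {x y} → x Fin.< y →
                     lookup w (lookup π x) ≡ false → lookup w (lookup π y) ≡ true → ⊥
  marks-decrease-⊥ {x} {y} x<y wₓ w_y with toℕ x ℕ.<? k
  ... | yes x<k = true≢false (trans (sym (marked x<k)) wₓ)
  ... | no x≮k  =
    true≢false (trans (sym w_y) (unmarked (ℕₚ.≤-trans (ℕₚ.≮⇒≥ x≮k) (ℕₚ.<⇒≤ x<y))))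

  h-mono : ∀ {x y} → x Fin.< y → h x Fin.< h y
  h-mono {x} {y} x<y with ℕₚ.<-cmp (π ! x) (π ! y)
  ... | tri< πx<πy _ _ = [ (λ (wₓ , w_y) → ⊥-elim (marks-decrease-⊥ x<y wₓ w_y)) , (λ hx<hy → hx<hy) ]′
                           (shuffleAt-<-cases w πx<πy)
  ... | tri≈ _ πx≡πy _ = ⊥-elim (ℕₚ.<-irrefl (cong toℕ (π-perm x y (toℕ-injective πx≡πy))) x<y)
  ... | tri> _ _ πy<πx with d , D , x≤d , d<y ← descent-between π x<y πy<πx =
    shuffleAt-false-true w (unmarked (subst (ℕ._≤ toℕ y) d+1≡k d<y))
                           (marked (subst (toℕ x ℕ.<_) d+1≡k (s≤s x≤d)))
    where
    d+1≡k : suc (toℕ d) ≡ k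
    d+1≡k = proj₂ (descentBound π grass) d D

words : ∀ n → List (Vec Bool n)
words zero    = [] ∷ []
words (suc n) = map (true ∷_) (words n) ++ map (false ∷_) (words n)

∈-words : (w : Vec Bool n) → w ∈ words n
∈-words []          = here refl
∈-words (true ∷ w)  = ∈-++⁺ˡ (∈-map⁺ (true ∷_) (∈-words w))
∈-words (false ∷ w) = ∈-++⁺ʳ (map (true ∷_) (words _)) (∈-map⁺ (false ∷_) (∈-words w))

words-unique : ∀ n → Unique (words n)
words-unique zero    = All.[] ∷ []
words-unique (suc n) =
  Uniqueₚ.++⁺ (Uniqueₚ.map⁺ ∷-injectiveʳ (words-unique n)) (Uniqueₚ.map⁺ ∷-injectiveʳ (words-unique n))
              heads-differ
  where
  heads-differ : ∀ {w} → ¬ (w ∈ map (true ∷_) (words n) × w ∈ map (false ∷_) (words n))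
  heads-differ (∈t , ∈f) with _ , _ , refl ← ∈-map⁻ (true ∷_) ∈t | _ , _ , () ← ∈-map⁻ (false ∷_) ∈f

count : ∀ n → (Vec Bool n → Bool) → ℕ
count n p = length (filter (T? ∘ p) (words n))

length-filter-map : {A B : Set} {P : B → Set} (P? : ∀ b → Dec (P b)) (f : A → B) (xs : List A) →
                    length (filter P? (map f xs)) ≡ length (filter (P? ∘ f) xs)
length-filter-map P? f []       = refl
length-filter-map P? f (x ∷ xs) with does (P? (f x))
... | true  = cong suc (length-filter-map P? f xs)
... | false = length-filter-map P? f xs

count-∷ : ∀ n (p : Vec Bool (suc n) → Bool) →
          count (suc n) p ≡ count n (p ∘ (true ∷_)) + count n (p ∘ (false ∷_))
count-∷ n p = begin
  length (filter (T? ∘ p) (ones ++ zeros))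
    ≡⟨ cong length (filter-++ (T? ∘ p) ones zeros) ⟩
  length (filter (T? ∘ p) ones ++ filter (T? ∘ p) zeros)
    ≡⟨ length-++ (filter (T? ∘ p) ones) ⟩
  length (filter (T? ∘ p) ones) + length (filter (T? ∘ p) zeros)
    ≡⟨ cong₂ _+_ (length-filter-map (T? ∘ p) (true ∷_) (words n))
                 (length-filter-map (T? ∘ p) (false ∷_) (words n)) ⟩
  count n (p ∘ (true ∷_)) + count n (p ∘ (false ∷_)) ∎
  where
  open ≡-Reasoning
  ones zeros : List (Vec Bool (suc n))
  ones  = map (true ∷_) (words n)
  zeros = map (false ∷_) (words n)

count-false : ∀ n → count n (λ _ → false) ≡ 0
count-false zero    = refl
count-false (suc n) = trans (count-∷ n (λ _ → false)) (cong₂ _+_ (count-false n) (count-false n))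

count-true : ∀ n → count n (λ _ → true) ≡ 2 ^ n
count-true zero    = refl
count-true (suc n) = trans (count-∷ n (λ _ → true)) (trans (cong₂ _+_ (count-true n) (count-true n))
                                                         (cong (2 ^ n +_) (sym (ℕₚ.+-identityʳ (2 ^ n)))))

count-cong : ∀ n {p q : Vec Bool n → Bool} → (∀ w → p w ≡ q w) → count n p ≡ count n q
count-cong n {p} {q} p≗q = cong length (filter-≐ (T? ∘ p) (T? ∘ q) (to , from) (words n))
  where
  to : ∀ {w} → T (p w) → T (q w)
  to {w} = subst T (p≗q w)
  from : ∀ {w} → T (q w) → T (p w)
  from {w} = subst T (sym (p≗q w))

count-∨ : ∀ n (p q : Vec Bool n → Bool) → (∀ w → p w ∧ q w ≡ false) →
          count n (λ w → p w ∨ q w) ≡ count n p + count n q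
count-∨ zero    p q disjoint with p [] | q [] | disjoint []
... | true  | false | _ = refl
... | false | true  | _ = refl
... | false | false | _ = refl
count-∨ (suc n) p q disjoint = begin
  count (suc n) (λ w → p w ∨ q w)
    ≡⟨ count-∷ n (λ w → p w ∨ q w) ⟩
  count n (λ w → p (true ∷ w) ∨ q (true ∷ w)) + count n (λ w → p (false ∷ w) ∨ q (false ∷ w))
    ≡⟨ cong₂ _+_ (count-∨ n _ _ (disjoint ∘ (true ∷_))) (count-∨ n _ _ (disjoint ∘ (false ∷_))) ⟩
  (p₁ + q₁) + (p₀ + q₀)
    ≡⟨ +-interchange p₁ q₁ p₀ q₀ ⟩
  (p₁ + p₀) + (q₁ + q₀)
    ≡⟨ sym (cong₂ _+_ (count-∷ n p) (count-∷ n q)) ⟩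
  count (suc n) p + count (suc n) q ∎
  where
  open ≡-Reasoning
  p₁ p₀ q₁ q₀ : ℕ
  p₁ = count n (p ∘ (true ∷_))
  p₀ = count n (p ∘ (false ∷_))
  q₁ = count n (q ∘ (true ∷_))
  q₀ = count n (q ∘ (false ∷_))

-- Split by the first letter: a leading true never starts an ascent, while a leading false
-- starts one exactly when the next letter is true.
count-false∷-ascents≡0 : ∀ n → count n (λ w → ascents (false ∷ w) ≡ᵇ 0) ≡ 1
count-false∷-ascents≡0 zero    = refl
count-false∷-ascents≡0 (suc n) =
  trans (count-∷ n _) (cong₂ _+_ (count-false n) (count-false∷-ascents≡0 n))

count-ascents≡0 : ∀ n → count n (λ w → ascents w ≡ᵇ 0) ≡ suc n
count-ascents≡0 zero    = refl
count-ascents≡0 (suc n) =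
  trans (count-∷ n _) (trans (cong₂ _+_ (count-ascents≡0 n) (count-false∷-ascents≡0 n)) (ℕₚ.+-comm (suc n) 1))

count-false∷-ascents≡1 : ∀ n → count n (λ w → ascents (false ∷ w) ≡ᵇ 1) ≡ suc n C 2
count-false∷-ascents≡1 zero    = refl
count-false∷-ascents≡1 (suc n) =
  trans (count-∷ n _)
        (trans (cong₂ _+_ (trans (count-ascents≡0 n) (sym (nC1≡n (suc n)))) (count-false∷-ascents≡1 n))
               (nCk+nC[k+1]≡[n+1]C[k+1] (suc n) 1))

count-ascents≡1 : ∀ n → count n (λ w → ascents w ≡ᵇ 1) ≡ suc n C 3
count-ascents≡1 zero    = refl
count-ascents≡1 (suc n) =
  trans (count-∷ n _) (trans (cong₂ _+_ (count-ascents≡1 n) (count-false∷-ascents≡1 n))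
                             (trans (ℕₚ.+-comm (suc n C 3) (suc n C 2)) (nCk+nC[k+1]≡[n+1]C[k+1] (suc n) 2)))

count-ascents>0 : ∀ n → suc n + count n (λ w → 0 <ᵇ ascents w) ≡ 2 ^ n
count-ascents>0 n = begin
  suc n + count n (λ w → 0 <ᵇ ascents w)
    ≡⟨ cong (_+ count n (λ w → 0 <ᵇ ascents w)) (sym (count-ascents≡0 n)) ⟩
  count n (λ w → ascents w ≡ᵇ 0) + count n (λ w → 0 <ᵇ ascents w)
    ≡⟨ sym (count-∨ n _ _ (disjoint ∘ ascents)) ⟩
  count n (λ w → (ascents w ≡ᵇ 0) ∨ (0 <ᵇ ascents w))
    ≡⟨ count-cong n (exhaustive ∘ ascents) ⟩
  count n (λ _ → true)
    ≡⟨ count-true n ⟩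
  2 ^ n ∎
  where
  open ≡-Reasoning
  disjoint : ∀ m → (m ≡ᵇ 0) ∧ (0 <ᵇ m) ≡ false
  disjoint zero    = refl
  disjoint (suc m) = refl
  exhaustive : ∀ m → (m ≡ᵇ 0) ∨ (0 <ᵇ m) ≡ true
  exhaustive zero    = refl
  exhaustive (suc m) = refl

count-ascents>0-split : ∀ n →
                        count n (λ w → 0 <ᵇ ascents w) ≡ suc n C 3 + count n (λ w → 1 <ᵇ ascents w)
count-ascents>0-split n = begin
  count n (λ w → 0 <ᵇ ascents w)
    ≡⟨ count-cong n (split ∘ ascents) ⟩
  count n (λ w → (ascents w ≡ᵇ 1) ∨ (1 <ᵇ ascents w))
    ≡⟨ count-∨ n _ _ (disjoint ∘ ascents) ⟩
  count n (λ w → ascents w ≡ᵇ 1) + count n (λ w → 1 <ᵇ ascents w)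
    ≡⟨ cong (_+ count n (λ w → 1 <ᵇ ascents w)) (count-ascents≡1 n) ⟩
  suc n C 3 + count n (λ w → 1 <ᵇ ascents w) ∎
  where
  open ≡-Reasoning
  split : ∀ m → (0 <ᵇ m) ≡ (m ≡ᵇ 1) ∨ (1 <ᵇ m)
  split zero          = refl
  split (suc zero)    = refl
  split (suc (suc m)) = refl
  disjoint : ∀ m → (m ≡ᵇ 1) ∧ (1 <ᵇ m) ≡ false
  disjoint zero          = refl
  disjoint (suc zero)    = refl
  disjoint (suc (suc m)) = refl

wordsWith>Ascents : ℕ → ∀ n → List (Vec Bool n)
wordsWith>Ascents k n = filter (λ w → T? (k <ᵇ ascents w)) (words n)

∈-wordsWith>Ascents⁺ : ∀ {k} (w : Vec Bool n) → k ℕ.< ascents w → w ∈ wordsWith>Ascents k n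
∈-wordsWith>Ascents⁺ {k = k} w k<a = ∈-filter⁺ (λ w → T? (k <ᵇ ascents w)) (∈-words w) (ℕₚ.<⇒<ᵇ k<a)

∈-wordsWith>Ascents⁻ : ∀ {k} {w : Vec Bool n} → w ∈ wordsWith>Ascents k n → k ℕ.< ascents w
∈-wordsWith>Ascents⁻ {n} {k} {w} w∈ =
  ℕₚ.<ᵇ⇒< k (ascents w) (proj₂ (∈-filter⁻ (λ w → T? (k <ᵇ ascents w)) {xs = words n} w∈))

allFin-isGrassmannian : InG (allFin n)
allFin-isGrassmannian =
  (λ i j eq → trans (sym (lookup-allFin i)) (trans eq (lookup-allFin j))) , λ i _ d _ → ⊥-elim (allFin-¬descent i d)

ascents≡0⇒shuffle≡allFin : (w : Vec Bool n) → ascents w ≡ 0 → shuffle w ≡ allFin n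
ascents≡0⇒shuffle≡allFin w a≡0 = noDescent⇒≡allFin (shuffle w) (shuffle-isPerm w) λ i d →
  ℕₚ.<-irrefl (sym a≡0) (ascentAt⇒1≤ascents w (descent-shuffle⇒ascentAt w d))

ascents≤1⇒shuffle-isGrassmannian : (w : Vec Bool n) → ascents w ℕ.≤ 1 → Grassmannian (shuffle w)
ascents≤1⇒shuffle-isGrassmannian w a≤1 i i′ d d′ with i Fin.≟ i′
... | yes i≡i′ = i≡i′
... | no i≢i′ =
  ⊥-elim (ℕₚ.<⇒≱ (twoAscents⇒2≤ascents w (descent-shuffle⇒ascentAt w d) (descent-shuffle⇒ascentAt w d′) i≢i′) a≤1)

shuffle-isGrassmannian⇒ascents≤1 : (w : Vec Bool n) → Grassmannian (shuffle w) → ascents w ℕ.≤ 1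
shuffle-isGrassmannian⇒ascents≤1 w grass = ℕₚ.≮⇒≥ λ 1<a →
  let i , i′ , a , a′ , i≢i′ = 2≤ascents⇒twoAscents w 1<a
  in  i≢i′ (grass i i′ (ascentAt⇒descent-shuffle w a) (ascentAt⇒descent-shuffle w a′))

grassmannians : ∀ n → List (Vec (Fin n) n)
grassmannians n = map (inverse ∘ shuffle) (wordsWith>Ascents 0 n) ++ allFin n ∷ []

InG⇒∈grassmannians : (π : Vec (Fin n) n) → InG π → π ∈ grassmannians n
InG⇒∈grassmannians {n} π (π-perm , grass)
  with w , shuffle≡π⁻¹ ← Grassmannian⇒inverse≡shuffle π (inverse π) π-perm grass
                                                      (inverse-isInverse π π-perm)
     | ascents w ℕ.≟ 0
... | no a≢0 =
  ∈-++⁺ˡ (subst (_∈ _) π≡ (∈-map⁺ (inverse ∘ shuffle) (∈-wordsWith>Ascents⁺ w (ℕₚ.n≢0⇒n>0 a≢0))))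
  where
  π≡ : inverse (shuffle w) ≡ π
  π≡ = trans (cong inverse shuffle≡π⁻¹) (inverse-involutive π π-perm)
... | yes a≡0 = ∈-++⁺ʳ _ (here π≡allFin)
  where
  π≡allFin : π ≡ allFin n
  π≡allFin =
    inverse≡allFin⇒≡allFin π π-perm (trans (sym shuffle≡π⁻¹) (ascents≡0⇒shuffle≡allFin w a≡0))

∈grassmannians⇒InG : {π : Vec (Fin n) n} → π ∈ grassmannians n → InG π
∈grassmannians⇒InG {n} π∈ with ∈-++⁻ (map (inverse ∘ shuffle) (wordsWith>Ascents 0 n)) π∈
... | inj₁ π∈₁ with w , _ , refl ← ∈-map⁻ (inverse ∘ shuffle) π∈₁ = inverse-shuffle-isGrassmannian w
... | inj₂ (here refl) = allFin-isGrassmannian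

nonGrassmannianShuffles : ∀ n → List (Vec (Fin n) n)
nonGrassmannianShuffles n = map shuffle (wordsWith>Ascents 1 n)

grassmannianUnion : ∀ n → List (Vec (Fin n) n)
grassmannianUnion n = nonGrassmannianShuffles n ++ grassmannians n

InGUnion⇒∈grassmannianUnion : (π : Vec (Fin n) n) → InGUnion π → π ∈ grassmannianUnion n
InGUnion⇒∈grassmannianUnion {n} π (inj₁ πᴳ) = ∈-++⁺ʳ (nonGrassmannianShuffles n) (InG⇒∈grassmannians π πᴳ)
InGUnion⇒∈grassmannianUnion {n} π (inj₂ (π-perm , σ , (σ-perm , σ-grass) , π∘σ≗id))
  with w , refl ← Grassmannian⇒inverse≡shuffle σ π σ-perm σ-grass (inverse-sym π σ π-perm π∘σ≗id)
     | 1 ℕ.<? ascents w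
... | yes 1<a = ∈-++⁺ˡ (∈-map⁺ shuffle (∈-wordsWith>Ascents⁺ w 1<a))
... | no 1≮a = ∈-++⁺ʳ (nonGrassmannianShuffles n)
  (InG⇒∈grassmannians (shuffle w) (π-perm , ascents≤1⇒shuffle-isGrassmannian w (ℕₚ.≮⇒≥ 1≮a)))

∈grassmannianUnion⇒InGUnion : (π : Vec (Fin n) n) → π ∈ grassmannianUnion n → InGUnion π
∈grassmannianUnion⇒InGUnion {n} π π∈ with ∈-++⁻ (nonGrassmannianShuffles n) π∈
... | inj₂ π∈ᴳ = inj₁ (∈grassmannians⇒InG π∈ᴳ)
... | inj₁ π∈ˢ with w , _ , refl ← ∈-map⁻ shuffle π∈ˢ =
  inj₂ (shuffle-isPerm w , inverse (shuffle w) , inverse-shuffle-isGrassmannian w ,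
        inverse-isInverse (shuffle w) (shuffle-isPerm w))

map⁺-injectiveOn : {A B : Set} {f : A → B} {xs : List A} →
                   (∀ {x y} → x ∈ xs → y ∈ xs → f x ≡ f y → x ≡ y) → Unique xs → Unique (map f xs)
map⁺-injectiveOn {xs = []}     _   []          = []
map⁺-injectiveOn {xs = x ∷ xs} inj (x∉ ∷ xs!) =
  Allₚ.map⁺ (All.tabulate λ y∈ fx≡fy → All.lookup x∉ y∈ (inj (here refl) (there y∈) fx≡fy)) ∷
  map⁺-injectiveOn (λ x∈ y∈ → inj (there x∈) (there y∈)) xs!

wordsWith>Ascents-unique : ∀ k n → Unique (wordsWith>Ascents k n)
wordsWith>Ascents-unique k n = Uniqueₚ.filter⁺ (λ w → T? (k <ᵇ ascents w)) (words-unique n)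

grassmannians-unique : ∀ n → Unique (grassmannians n)
grassmannians-unique n =
  Uniqueₚ.++⁺ (map⁺-injectiveOn injective (wordsWith>Ascents-unique 0 n)) (All.[] ∷ []) allFin∉
  where
  injective : ∀ {w w′} → w ∈ wordsWith>Ascents 0 n → w′ ∈ wordsWith>Ascents 0 n →
              inverse (shuffle w) ≡ inverse (shuffle w′) → w ≡ w′
  injective {w} {w′} w∈ _ eq = shuffle-injective w w′ (∈-wordsWith>Ascents⁻ w∈)
    (trans (sym (inverse-involutive (shuffle w) (shuffle-isPerm w)))
           (trans (cong inverse eq) (inverse-involutive (shuffle w′) (shuffle-isPerm w′))))
  allFin∉ : ∀ {π} → ¬ (π ∈ map (inverse ∘ shuffle) (wordsWith>Ascents 0 n) × π ∈ allFin n ∷ [])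
  allFin∉ (π∈ , here refl) with w , w∈ , allFin≡ ← ∈-map⁻ (inverse ∘ shuffle) π∈
                           with i , a ← 1≤ascents⇒ascentAt w (∈-wordsWith>Ascents⁻ w∈) =
    allFin-¬descent i (subst (λ π → DescentAt π i)
      (inverse≡allFin⇒≡allFin (shuffle w) (shuffle-isPerm w) (sym allFin≡)) (ascentAt⇒descent-shuffle w a))

grassmannianUnion-unique : ∀ n → Unique (grassmannianUnion n)
grassmannianUnion-unique n =
  Uniqueₚ.++⁺ (map⁺-injectiveOn injective (wordsWith>Ascents-unique 1 n)) (grassmannians-unique n) disjoint
  where
  injective : ∀ {w w′} → w ∈ wordsWith>Ascents 1 n → w′ ∈ wordsWith>Ascents 1 n →
              shuffle w ≡ shuffle w′ → w ≡ w′
  injective {w} {w′} w∈ _ = shuffle-injective w w′ (ℕₚ.<⇒≤ (∈-wordsWith>Ascents⁻ w∈))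
  disjoint : ∀ {π} → ¬ (π ∈ nonGrassmannianShuffles n × π ∈ grassmannians n)
  disjoint (π∈ˢ , π∈ᴳ) with w , w∈ , refl ← ∈-map⁻ shuffle π∈ˢ =
    ℕₚ.<⇒≱ (∈-wordsWith>Ascents⁻ w∈)
           (shuffle-isGrassmannian⇒ascents≤1 w (proj₂ (∈grassmannians⇒InG π∈ᴳ)))

length-grassmannianUnion : ∀ n → length (grassmannianUnion n) ≡
                           count n (λ w → 1 <ᵇ ascents w) + (count n (λ w → 0 <ᵇ ascents w) + 1)
length-grassmannianUnion n =
  trans (length-++ (nonGrassmannianShuffles n))
        (cong₂ _+_ (length-map shuffle (wordsWith>Ascents 1 n))
                   (trans (length-++ (map (inverse ∘ shuffle) (wordsWith>Ascents 0 n)))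
                          (cong (_+ 1) (length-map (inverse ∘ shuffle) (wordsWith>Ascents 0 n)))))

length-grassmannianUnion-formula : ∀ n →
                                   length (grassmannianUnion n) + (n + 1) C 3 + 2 * n + 1 ≡ 2 ^ (n + 1)
length-grassmannianUnion-formula n = begin
  length (grassmannianUnion n) + (n + 1) C 3 + 2 * n + 1
    ≡⟨ cong₂ (λ l m → l + m + 2 * n + 1) (length-grassmannianUnion n) (cong (_C 3) (ℕₚ.+-comm n 1)) ⟩
  (a + (b + 1)) + c + 2 * n + 1
    ≡⟨ cong (λ x → (a + (x + 1)) + c + 2 * n + 1) (count-ascents>0-split n) ⟩
  (a + ((c + a) + 1)) + c + 2 * n + 1
    ≡⟨ rearrange a c n ⟩
  2 * (suc n + (c + a))
    ≡⟨ cong (λ x → 2 * (suc n + x)) (sym (count-ascents>0-split n)) ⟩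
  2 * (suc n + b)
    ≡⟨ cong (2 *_) (count-ascents>0 n) ⟩
  2 ^ suc n
    ≡⟨ cong (2 ^_) (ℕₚ.+-comm 1 n) ⟩
  2 ^ (n + 1) ∎
  where
  open ≡-Reasoning
  a b c : ℕ
  a = count n (λ w → 1 <ᵇ ascents w)
  b = count n (λ w → 0 <ᵇ ascents w)
  c = suc n C 3
  rearrange : ∀ a c n → (a + ((c + a) + 1)) + c + 2 * n + 1 ≡ 2 * (suc n + (c + a))
  rearrange = solve 3 (λ a c n → (a :+ ((c :+ a) :+ con 1)) :+ c :+ con 2 :* n :+ con 1
                              := con 2 :* ((con 1 :+ n) :+ (c :+ a))) refl
    where open +-*-Solver

mainTheorem2 : (n : ℕ) →
    ((π : Vec (Fin n) n) → InGUnion π ⇔ InAvoid π)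
    × Σ (List (Vec (Fin n) n)) (λ L →
        Unique L
        × ((π : Vec (Fin n) n) → π ∈ L ⇔ InGUnion π)
        × (length L + (n + 1) C 3 + 2 * n + 1 ≡ 2 ^ (n + 1)))
mainTheorem2 n =
  (λ π → mk⇔ (InGUnion⇒InAvoid π) (InAvoid⇒InGUnion π)) ,
  grassmannianUnion n ,
  grassmannianUnion-unique n ,
  (λ π → mk⇔ (∈grassmannianUnion⇒InGUnion π) (InGUnion⇒∈grassmannianUnion π)) ,
  length-grassmannianUnion-formula n
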